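{- Let $p(x),q(x)\in\mathbb{Z}[x]$ satisfy $p(x)-p(-x)=q(x)-q(-x)$. Then $p({\bf a}-{\bf b})+q({\bf b}-{\bf a})\in\mathbb{Z}\langle{\bf c},{\bf d}\rangle$ and $p({\bf a}-{\bf b})\cdot{\bf b}+p({\bf b}-{\bf a})\cdot{\bf a}\in\mathbb{Z}\langle{\bf c},{\bf d}\rangle$.
   Context: ${\bf a},{\bf b}$ are non-commuting variables; $\mathbb{Z}\langle{\bf a},{\bf b}\rangle$ is the non-commutative polynomial ring over $\mathbb{Z}$. ${\bf c}={\bf a}+{\bf b}$, ${\bf d}={\bf a}{\bf b}+{\bf b}{\bf a}$, and $\mathbb{Z}\langle{\bf c},{\bf d}\rangle\subseteq\mathbb{Z}\langle{\bf a},{\bf b}\rangle$ is the set of integer linear combinations of words in ${\bf c},{\bf d}$. -}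

module Defs where

open import Data.Bool using (Bool; true; false)
import Data.Bool as B
open import Data.Nat using (ℕ; zero; suc)
open import Data.Integer using (ℤ; 0ℤ; 1ℤ; _+_; _-_; _*_; -_; _^_)
open import Data.List using (List; []; _∷_; _++_; map; concatMap)
open import Data.List.Properties using (≡-dec)
open import Data.Product using (_×_; _,_; Σ)
open import Relation.Nullary using (yes; no)
open import Relation.Binary.PropositionalEquality using (_≡_)

-- A monomial (word) is a list of letters: false = a, true = b.
-- An element is a formal finite ℤ-linear combination of words; two
-- elements are equal in ℤ⟨a,b⟩ iff all their word-coefficients agree.

Letter : Set
Letter = Bool

Word : Set
Word = List Letter

NC : Set
NC = List (ℤ × Word)

coeff : NC → Word → ℤ
coeff [] w = 0ℤ
coeff ((z , u) ∷ xs) w with ≡-dec B._≟_ u w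
... | yes _ = z + coeff xs w
... | no  _ = coeff xs w

_≈_ : NC → NC → Set
x ≈ y = ∀ w → coeff x w ≡ coeff y w

infix 4 _≈_
infixl 6 _⊕_
infixl 7 _⊗_

_⊕_ : NC → NC → NC
x ⊕ y = x ++ y

⊖_ : NC → NC
⊖ x = map (λ { (z , u) → (- z , u) }) x

_⊗_ : NC → NC → NC
x ⊗ y = concatMap (λ { (z , u) → map (λ { (z′ , v) → (z * z′ , u ++ v) }) y }) x

const : ℤ → NC
const z = (z , []) ∷ []

𝐚 𝐛 𝐜 𝐝 : NC
𝐚 = (1ℤ , false ∷ []) ∷ []
𝐛 = (1ℤ , true ∷ []) ∷ []
𝐜 = 𝐚 ⊕ 𝐛
𝐝 = 𝐚 ⊗ 𝐛 ⊕ 𝐛 ⊗ 𝐚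

-- ℤ⟨c,d⟩: integer linear combinations of words in c, d.
-- A word in c,d: list of letters (false = c, true = d).

CDExpr : Set
CDExpr = List (ℤ × List Bool)

evalCDWord : List Bool → NC
evalCDWord [] = const 1ℤ
evalCDWord (false ∷ w) = 𝐜 ⊗ evalCDWord w
evalCDWord (true  ∷ w) = 𝐝 ⊗ evalCDWord w

evalCD : CDExpr → NC
evalCD [] = []
evalCD ((z , w) ∷ e) = const z ⊗ evalCDWord w ⊕ evalCD e

InCD : NC → Set
InCD x = Σ CDExpr λ e → evalCD e ≈ x

-- ℤ[x]: polynomials as coefficient lists p = p₀ ∷ p₁ ∷ … (ascending).

Poly : Set
Poly = List ℤ

pcoeff : Poly → ℕ → ℤ
pcoeff [] i = 0ℤ
pcoeff (c ∷ cs) zero = c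
pcoeff (c ∷ cs) (suc i) = pcoeff cs i

-- i-th coefficient of p(x) - p(-x)
oddPartCoeff : Poly → ℕ → ℤ
oddPartCoeff p i = pcoeff p i - (- 1ℤ) ^ i * pcoeff p i

OddPartsEqual : Poly → Poly → Set
OddPartsEqual p q = ∀ i → oddPartCoeff p i ≡ oddPartCoeff q i

evalP : Poly → NC → NC
evalP [] t = []
evalP (c ∷ cs) t = const c ⊕ t ⊗ evalP cs t

module Submission where

-- Write t = a - b and s = b - a = -t.  Since t² = c² - 2d, the subring
-- ℤ⟨c,d⟩ is closed under multiplication by t², and both claims follow by
-- induction on the polynomials, peeling off two coefficients at a time:
--   p(t) + q(s)     = (p₀ + q₀) + t²·(p″(t) + q″(s))            if p₁ = q₁,
--   p(t)b + p(s)a   = p₀·c + t²·(-p₁ + p″(t)b + p″(s)a),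
-- where p = p₀ + p₁x + x²p″ (and likewise for q); the hypothesis on odd
-- parts gives p₁ = q₁ and is inherited by p″, q″.
--
-- Identities in ℤ⟨a,b⟩ are proved through linear functionals: an element x
-- is paired with a test function f on words, ⟨ x ∣ f ⟩ = Σ coeff x w · f w.
-- Two elements are equal iff all their pairings agree, and the pairing turns
-- sums and products in ℤ⟨a,b⟩ into integer arithmetic, so every identity we
-- need reduces to a commutative ring identity in ℤ.

open import Defs
open import Data.Bool using (Bool; true; false)
import Data.Bool as Bool
open import Data.Nat using (zero; suc; _≤_; s≤s) renaming (_+_ to _+ℕ_)
import Data.Nat.Properties as ℕ
open import Data.Integer using (ℤ; 0ℤ; 1ℤ; _+_; _-_; _*_; -_; _^_)
import Data.Integer.Properties as ℤ
open import Data.Integer.Tactic.RingSolver using (solve-∀)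
open import Data.List using (List; []; _∷_; _++_; length; drop)
open import Data.List.Properties using (≡-dec; ++-assoc; ++-identityʳ)
open import Data.Product using (_×_; _,_)
open import Data.Empty using (⊥-elim)
open import Relation.Binary.PropositionalEquality
open import Relation.Nullary using (yes; no)

infix 4 ⟨_∣_⟩

⟨_∣_⟩ : NC → (Word → ℤ) → ℤ
⟨ [] ∣ f ⟩ = 0ℤ
⟨ (z , u) ∷ x ∣ f ⟩ = z * f u + ⟨ x ∣ f ⟩

pair-cong : ∀ x {f g} → (∀ u → f u ≡ g u) → ⟨ x ∣ f ⟩ ≡ ⟨ x ∣ g ⟩
pair-cong [] f≗g = refl
pair-cong ((z , u) ∷ x) f≗g = cong₂ (λ a b → z * a + b) (f≗g u) (pair-cong x f≗g)

pair-zero : ∀ x → ⟨ x ∣ (λ _ → 0ℤ) ⟩ ≡ 0ℤ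
pair-zero [] = refl
pair-zero ((z , u) ∷ x) =
  trans (cong (z * 0ℤ +_) (pair-zero x)) (trans (ℤ.+-identityʳ _) (ℤ.*-zeroʳ z))

pair-+ : ∀ x g h → ⟨ x ∣ (λ u → g u + h u) ⟩ ≡ ⟨ x ∣ g ⟩ + ⟨ x ∣ h ⟩
pair-+ [] g h = refl
pair-+ ((z , u) ∷ x) g h =
  trans (cong (z * (g u + h u) +_) (pair-+ x g h)) (interchange z (g u) (h u) _ _)
  where
  interchange : ∀ z a b c d → z * (a + b) + (c + d) ≡ (z * a + c) + (z * b + d)
  interchange = solve-∀

pair-* : ∀ x k g → ⟨ x ∣ (λ u → k * g u) ⟩ ≡ k * ⟨ x ∣ g ⟩
pair-* [] k g = sym (ℤ.*-zeroʳ k)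
pair-* ((z , u) ∷ x) k g = trans (cong (z * (k * g u) +_) (pair-* x k g)) (factor z k (g u) _)
  where
  factor : ∀ z k a b → z * (k * a) + k * b ≡ k * (z * a + b)
  factor = solve-∀

pair-swap : ∀ x y (F : Word → Word → ℤ) →
            ⟨ x ∣ (λ u → ⟨ y ∣ (λ v → F u v) ⟩) ⟩ ≡ ⟨ y ∣ (λ v → ⟨ x ∣ (λ u → F u v) ⟩) ⟩
pair-swap [] y F = sym (pair-zero y)
pair-swap ((z , u) ∷ x) y F = begin
  z * ⟨ y ∣ F u ⟩ + ⟨ x ∣ (λ u′ → ⟨ y ∣ F u′ ⟩) ⟩
    ≡⟨ cong₂ _+_ (sym (pair-* y z (F u))) (pair-swap x y F) ⟩
  ⟨ y ∣ (λ v → z * F u v) ⟩ + ⟨ y ∣ (λ v → ⟨ x ∣ (λ u′ → F u′ v) ⟩) ⟩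
    ≡⟨ sym (pair-+ y _ _) ⟩
  ⟨ y ∣ (λ v → z * F u v + ⟨ x ∣ (λ u′ → F u′ v) ⟩) ⟩ ∎
  where open ≡-Reasoning

pair-⊕ : ∀ x y f → ⟨ x ⊕ y ∣ f ⟩ ≡ ⟨ x ∣ f ⟩ + ⟨ y ∣ f ⟩
pair-⊕ [] y f = sym (ℤ.+-identityˡ _)
pair-⊕ ((z , u) ∷ x) y f =
  trans (cong (z * f u +_) (pair-⊕ x y f)) (sym (ℤ.+-assoc (z * f u) _ _))

pair-⊖ : ∀ x f → ⟨ ⊖ x ∣ f ⟩ ≡ - ⟨ x ∣ f ⟩
pair-⊖ [] f = refl
pair-⊖ ((z , u) ∷ x) f = trans (cong ((- z) * f u +_) (pair-⊖ x f)) (negate z (f u) _)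
  where
  negate : ∀ z a b → (- z) * a + - b ≡ - (z * a + b)
  negate = solve-∀

pair-const : ∀ k f → ⟨ const k ∣ f ⟩ ≡ k * f []
pair-const k f = ℤ.+-identityʳ (k * f [])

pair-monomial-⊗ : ∀ z u y f → ⟨ ((z , u) ∷ []) ⊗ y ∣ f ⟩ ≡ z * ⟨ y ∣ (λ v → f (u ++ v)) ⟩
pair-monomial-⊗ z u [] f = sym (ℤ.*-zeroʳ z)
pair-monomial-⊗ z u ((z′ , v) ∷ y) f =
  trans (cong ((z * z′) * f (u ++ v) +_) (pair-monomial-⊗ z u y f)) (factor z z′ _ _)
  where
  factor : ∀ z z′ a b → (z * z′) * a + z * b ≡ z * (z′ * a + b)
  factor = solve-∀

⊗-cons : ∀ z u x y → ((z , u) ∷ x) ⊗ y ≡ ((z , u) ∷ []) ⊗ y ⊕ x ⊗ y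
⊗-cons z u x y = cong (_++ x ⊗ y) (sym (++-identityʳ _))

pair-⊗ : ∀ x y f → ⟨ x ⊗ y ∣ f ⟩ ≡ ⟨ x ∣ (λ u → ⟨ y ∣ (λ v → f (u ++ v)) ⟩) ⟩
pair-⊗ [] y f = refl
pair-⊗ ((z , u) ∷ x) y f = begin
  ⟨ ((z , u) ∷ x) ⊗ y ∣ f ⟩
    ≡⟨ cong ⟨_∣ f ⟩ (⊗-cons z u x y) ⟩
  ⟨ ((z , u) ∷ []) ⊗ y ⊕ x ⊗ y ∣ f ⟩
    ≡⟨ pair-⊕ (((z , u) ∷ []) ⊗ y) (x ⊗ y) f ⟩
  ⟨ ((z , u) ∷ []) ⊗ y ∣ f ⟩ + ⟨ x ⊗ y ∣ f ⟩
    ≡⟨ cong₂ _+_ (pair-monomial-⊗ z u y f) (pair-⊗ x y f) ⟩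
  z * ⟨ y ∣ (λ v → f (u ++ v)) ⟩ + ⟨ x ∣ (λ u′ → ⟨ y ∣ (λ v → f (u′ ++ v)) ⟩) ⟩ ∎
  where open ≡-Reasoning

δ : Word → Word → ℤ
δ u w with ≡-dec Bool._≟_ u w
... | yes _ = 1ℤ
... | no _ = 0ℤ

coeff-pairing : ∀ x w → coeff x w ≡ ⟨ x ∣ (λ u → δ u w) ⟩
coeff-pairing [] w = refl
coeff-pairing ((z , u) ∷ x) w with ≡-dec Bool._≟_ u w
... | yes _ = cong₂ _+_ (sym (ℤ.*-identityʳ z)) (coeff-pairing x w)
... | no _ = trans (coeff-pairing x w)
                   (sym (trans (cong (_+ ⟨ x ∣ (λ u → δ u w) ⟩) (ℤ.*-zeroʳ z)) (ℤ.+-identityˡ _)))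

-- Equality in ℤ⟨a,b⟩, packaged as a record so that both sides can be
-- recovered from its type (the coefficient function is not injective).
infix 4 _≃_

record _≃_ (x y : NC) : Set where
  constructor coeffwise
  field coeffs : x ≈ y

open _≃_

≃-refl : ∀ {x} → x ≃ x
≃-refl = coeffwise λ w → refl

≃-sym : ∀ {x y} → x ≃ y → y ≃ x
≃-sym x≃y = coeffwise λ w → sym (coeffs x≃y w)

≃-trans : ∀ {x y z} → x ≃ y → y ≃ z → x ≃ z
≃-trans x≃y y≃z = coeffwise λ w → trans (coeffs x≃y w) (coeffs y≃z w)

pairing-ext : ∀ {x y} → (∀ f → ⟨ x ∣ f ⟩ ≡ ⟨ y ∣ f ⟩) → x ≃ y
pairing-ext {x} {y} same = coeffwise λ w →
  trans (coeff-pairing x w) (trans (same (λ u → δ u w)) (sym (coeff-pairing y w)))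

without : Word → NC → NC
without u [] = []
without u ((z , v) ∷ x) with ≡-dec Bool._≟_ v u
... | yes _ = without u x
... | no _ = (z , v) ∷ without u x

pair-without : ∀ u x f → ⟨ x ∣ f ⟩ ≡ coeff x u * f u + ⟨ without u x ∣ f ⟩
pair-without u [] f = sym (zero-term (f u))
  where
  zero-term : ∀ a → 0ℤ * a + 0ℤ ≡ 0ℤ
  zero-term = solve-∀
pair-without u ((z , v) ∷ x) f with ≡-dec Bool._≟_ v u
... | yes refl = trans (cong (z * f v +_) (pair-without v x f)) (collect z (coeff x v) (f v) _)
  where
  collect : ∀ z k a b → z * a + (k * a + b) ≡ (z + k) * a + b
  collect = solve-∀
... | no _ = trans (cong (z * f v +_) (pair-without u x f))
                   (exchange (z * f v) (coeff x u * f u) ⟨ without u x ∣ f ⟩)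
  where
  exchange : ∀ a b c → a + (b + c) ≡ b + (a + c)
  exchange = solve-∀

without-head : ∀ z u x → without u ((z , u) ∷ x) ≡ without u x
without-head z u x with ≡-dec Bool._≟_ u u
... | yes _ = refl
... | no u≢u = ⊥-elim (u≢u refl)

length-without : ∀ u x → length (without u x) ≤ length x
length-without u [] = ℕ.≤-refl
length-without u ((z , v) ∷ x) with ≡-dec Bool._≟_ v u
... | yes _ = ℕ.m≤n⇒m≤1+n (length-without u x)
... | no _ = s≤s (length-without u x)

without-vanishes : ∀ u x → (∀ w → coeff x w ≡ 0ℤ) → ∀ w → coeff (without u x) w ≡ 0ℤ
without-vanishes u x x≈0 w = begin
  coeff (without u x) w                          ≡⟨ sym (zero-term (δ u w) (coeff (without u x) w)) ⟩
  0ℤ * δ u w + coeff (without u x) w             ≡⟨ cong (λ c → c * δ u w + coeff (without u x) w) (sym (x≈0 u)) ⟩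
  coeff x u * δ u w + coeff (without u x) w      ≡⟨ sym split ⟩
  coeff x w                                      ≡⟨ x≈0 w ⟩
  0ℤ                                             ∎
  where
  open ≡-Reasoning
  zero-term : ∀ a b → 0ℤ * a + b ≡ b
  zero-term = solve-∀
  split : coeff x w ≡ coeff x u * δ u w + coeff (without u x) w
  split = trans (coeff-pairing x w)
            (trans (pair-without u x (λ v → δ v w))
                   (cong (coeff x u * δ u w +_) (sym (coeff-pairing (without u x) w))))

-- An element with all coefficients zero has all pairings zero
-- (induction on its length, removing one word at a time).
vanish : ∀ n x → length x ≤ n → (∀ w → coeff x w ≡ 0ℤ) → ∀ f → ⟨ x ∣ f ⟩ ≡ 0ℤ
vanish _ [] _ _ _ = refl
vanish (suc n) ((z , u) ∷ x) (s≤s |x|≤n) x≈0 f = begin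
  ⟨ (z , u) ∷ x ∣ f ⟩                        ≡⟨ pair-without u ((z , u) ∷ x) f ⟩
  coeff ((z , u) ∷ x) u * f u + ⟨ rest ∣ f ⟩  ≡⟨ cong₂ (λ c r → c * f u + r) (x≈0 u) rest≈0 ⟩
  0ℤ * f u + 0ℤ                               ≡⟨ zero-term (f u) ⟩
  0ℤ                                          ∎
  where
  open ≡-Reasoning
  rest : NC
  rest = without u ((z , u) ∷ x)
  rest-shorter : length rest ≤ n
  rest-shorter = subst (λ r → length r ≤ n) (sym (without-head z u x))
                       (ℕ.≤-trans (length-without u x) |x|≤n)
  rest≈0 : ⟨ rest ∣ f ⟩ ≡ 0ℤ
  rest≈0 = vanish n rest rest-shorter (without-vanishes u ((z , u) ∷ x) x≈0) f
  zero-term : ∀ a → 0ℤ * a + 0ℤ ≡ 0ℤ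
  zero-term = solve-∀

-- Equal elements have equal pairings: x - y has zero coefficients.
pairing-resp : ∀ {x y} → x ≃ y → ∀ f → ⟨ x ∣ f ⟩ ≡ ⟨ y ∣ f ⟩
pairing-resp {x} {y} x≃y f =
  ℤ.i-j≡0⇒i≡j _ _ (trans (sym (pair-difference f))
                         (vanish (length (x ⊕ ⊖ y)) (x ⊕ ⊖ y) ℕ.≤-refl difference≈0 f))
  where
  pair-difference : ∀ g → ⟨ x ⊕ ⊖ y ∣ g ⟩ ≡ ⟨ x ∣ g ⟩ - ⟨ y ∣ g ⟩
  pair-difference g = trans (pair-⊕ x (⊖ y) g) (cong (⟨ x ∣ g ⟩ +_) (pair-⊖ y g))
  difference≈0 : ∀ w → coeff (x ⊕ ⊖ y) w ≡ 0ℤ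
  difference≈0 w = begin
    coeff (x ⊕ ⊖ y) w                                  ≡⟨ coeff-pairing (x ⊕ ⊖ y) w ⟩
    ⟨ x ⊕ ⊖ y ∣ (λ u → δ u w) ⟩                         ≡⟨ pair-difference (λ u → δ u w) ⟩
    ⟨ x ∣ (λ u → δ u w) ⟩ - ⟨ y ∣ (λ u → δ u w) ⟩      ≡⟨ cong₂ _-_ (sym (coeff-pairing x w)) (sym (coeff-pairing y w)) ⟩
    coeff x w - coeff y w                               ≡⟨ ℤ.i≡j⇒i-j≡0 (coeffs x≃y w) ⟩
    0ℤ                                                  ∎
    where open ≡-Reasoning

⊕-cong : ∀ {x x′ y y′} → x ≃ x′ → y ≃ y′ → x ⊕ y ≃ x′ ⊕ y′
⊕-cong {x} {x′} {y} {y′} x≃x′ y≃y′ = pairing-ext λ f → begin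
  ⟨ x ⊕ y ∣ f ⟩              ≡⟨ pair-⊕ x y f ⟩
  ⟨ x ∣ f ⟩ + ⟨ y ∣ f ⟩      ≡⟨ cong₂ _+_ (pairing-resp x≃x′ f) (pairing-resp y≃y′ f) ⟩
  ⟨ x′ ∣ f ⟩ + ⟨ y′ ∣ f ⟩    ≡⟨ sym (pair-⊕ x′ y′ f) ⟩
  ⟨ x′ ⊕ y′ ∣ f ⟩            ∎
  where open ≡-Reasoning

⊗-cong : ∀ {x x′ y y′} → x ≃ x′ → y ≃ y′ → x ⊗ y ≃ x′ ⊗ y′
⊗-cong {x} {x′} {y} {y′} x≃x′ y≃y′ = pairing-ext λ f → begin
  ⟨ x ⊗ y ∣ f ⟩                                     ≡⟨ pair-⊗ x y f ⟩
  ⟨ x ∣ (λ u → ⟨ y ∣ (λ v → f (u ++ v)) ⟩) ⟩        ≡⟨ pairing-resp x≃x′ _ ⟩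
  ⟨ x′ ∣ (λ u → ⟨ y ∣ (λ v → f (u ++ v)) ⟩) ⟩       ≡⟨ pair-cong x′ (λ u → pairing-resp y≃y′ _) ⟩
  ⟨ x′ ∣ (λ u → ⟨ y′ ∣ (λ v → f (u ++ v)) ⟩) ⟩      ≡⟨ sym (pair-⊗ x′ y′ f) ⟩
  ⟨ x′ ⊗ y′ ∣ f ⟩                                   ∎
  where open ≡-Reasoning

-- Terms over ℤ⟨a,b⟩ with opaque atoms.  Their pairings unfold (Sem) to
-- integer expressions in f and in pairings of the atoms, so an identity
-- between terms follows from a ring identity in ℤ (byPairing).
infixl 6 _⊞_
infixl 7 _⊠_

data Tm : Set where
  atom   : NC → Tm
  letter : Letter → Tm
  scalar : ℤ → Tm
  _⊞_ _⊠_ : Tm → Tm → Tm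
  neg    : Tm → Tm

⟦_⟧ : Tm → NC
⟦ atom x ⟧ = x
⟦ letter l ⟧ = (1ℤ , l ∷ []) ∷ []
⟦ scalar k ⟧ = const k
⟦ e ⊞ e′ ⟧ = ⟦ e ⟧ ⊕ ⟦ e′ ⟧
⟦ e ⊠ e′ ⟧ = ⟦ e ⟧ ⊗ ⟦ e′ ⟧
⟦ neg e ⟧ = ⊖ ⟦ e ⟧

Sem : Tm → (Word → ℤ) → ℤ
Sem (atom x) f = ⟨ x ∣ f ⟩
Sem (letter l) f = f (l ∷ [])
Sem (scalar k) f = k * f []
Sem (e ⊞ e′) f = Sem e f + Sem e′ f
Sem (e ⊠ e′) f = Sem e (λ u → Sem e′ (λ v → f (u ++ v)))
Sem (neg e) f = - Sem e f

pair-⟦⟧ : ∀ e f → ⟨ ⟦ e ⟧ ∣ f ⟩ ≡ Sem e f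
pair-⟦⟧ (atom x) f = refl
pair-⟦⟧ (letter l) f = trans (ℤ.+-identityʳ _) (ℤ.*-identityˡ _)
pair-⟦⟧ (scalar k) f = pair-const k f
pair-⟦⟧ (e ⊞ e′) f = trans (pair-⊕ ⟦ e ⟧ ⟦ e′ ⟧ f) (cong₂ _+_ (pair-⟦⟧ e f) (pair-⟦⟧ e′ f))
pair-⟦⟧ (e ⊠ e′) f =
  trans (pair-⊗ ⟦ e ⟧ ⟦ e′ ⟧ f) (trans (pair-cong ⟦ e ⟧ (λ u → pair-⟦⟧ e′ _)) (pair-⟦⟧ e _))
pair-⟦⟧ (neg e) f = trans (pair-⊖ ⟦ e ⟧ f) (cong -_ (pair-⟦⟧ e f))

byPairing : ∀ e e′ → (∀ f → Sem e f ≡ Sem e′ f) → ⟦ e ⟧ ≃ ⟦ e′ ⟧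
byPairing e e′ same =
  pairing-ext λ f → trans (pair-⟦⟧ e f) (trans (same f) (sym (pair-⟦⟧ e′ f)))

𝐭 𝐬 : NC
𝐭 = 𝐚 ⊕ ⊖ 𝐛
𝐬 = 𝐛 ⊕ ⊖ 𝐚

a b : Tm
a = letter false
b = letter true

tT sT cT dT : Tm
tT = a ⊞ neg b
sT = b ⊞ neg a
cT = a ⊞ b
dT = a ⊠ b ⊞ b ⊠ a

horner₂ : NC → ℤ → ℤ → NC → NC
horner₂ x α κ X = const α ⊕ x ⊗ (const κ ⊕ x ⊗ X)

sum-step-identity : ∀ α β {κ κ′} X Y → κ ≡ κ′ →
  horner₂ 𝐭 α κ X ⊕ horner₂ 𝐬 β κ′ Y ≃ const (α + β) ⊕ (𝐭 ⊗ 𝐭) ⊗ (X ⊕ Y)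
sum-step-identity α β {κ} X Y refl =
  byPairing (scalar α ⊞ tT ⊠ (scalar κ ⊞ tT ⊠ atom X) ⊞ (scalar β ⊞ sT ⊠ (scalar κ ⊞ sT ⊠ atom Y)))
            (scalar (α + β) ⊞ (tT ⊠ tT) ⊠ (atom X ⊞ atom Y))
  λ f → ring α β κ (f []) (f (false ∷ [])) (f (true ∷ []))
          (X-at f false false) (X-at f false true) (X-at f true false) (X-at f true true)
          (Y-at f false false) (Y-at f false true) (Y-at f true false) (Y-at f true true)
  where
  X-at Y-at : (Word → ℤ) → Letter → Letter → ℤ
  X-at f l l′ = ⟨ X ∣ (λ v → f (l ∷ l′ ∷ v)) ⟩
  Y-at f l l′ = ⟨ Y ∣ (λ v → f (l ∷ l′ ∷ v)) ⟩
  ring : ∀ α β κ F Fa Fb Xaa Xab Xba Xbb Yaa Yab Yba Ybb →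
      (α * F + ((κ * Fa + (Xaa - Xab)) - (κ * Fb + (Xba - Xbb))))
    + (β * F + ((κ * Fb + (Ybb - Yba)) - (κ * Fa + (Yab - Yaa))))
    ≡ (α + β) * F + (((Xaa + Yaa) - (Xab + Yab)) - ((Xba + Yba) - (Xbb + Ybb)))
  ring = solve-∀

twist-step-identity : ∀ α κ X Y →
  horner₂ 𝐭 α κ X ⊗ 𝐛 ⊕ horner₂ 𝐬 α κ Y ⊗ 𝐚
    ≃ const α ⊗ 𝐜 ⊕ (𝐭 ⊗ 𝐭) ⊗ (const (- κ) ⊕ (X ⊗ 𝐛 ⊕ Y ⊗ 𝐚))
twist-step-identity α κ X Y =
  byPairing ((scalar α ⊞ tT ⊠ (scalar κ ⊞ tT ⊠ atom X)) ⊠ b ⊞ (scalar α ⊞ sT ⊠ (scalar κ ⊞ sT ⊠ atom Y)) ⊠ a)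
            (scalar α ⊠ cT ⊞ (tT ⊠ tT) ⊠ (scalar (- κ) ⊞ (atom X ⊠ b ⊞ atom Y ⊠ a)))
  λ f → ring α κ (f (false ∷ [])) (f (true ∷ []))
          (f (false ∷ false ∷ [])) (f (false ∷ true ∷ [])) (f (true ∷ false ∷ [])) (f (true ∷ true ∷ []))
          (X-at f false false) (X-at f false true) (X-at f true false) (X-at f true true)
          (Y-at f false false) (Y-at f false true) (Y-at f true false) (Y-at f true true)
  where
  X-at Y-at : (Word → ℤ) → Letter → Letter → ℤ
  X-at f l l′ = ⟨ X ∣ (λ v → f (l ∷ l′ ∷ v ++ true ∷ [])) ⟩
  Y-at f l l′ = ⟨ Y ∣ (λ v → f (l ∷ l′ ∷ v ++ false ∷ [])) ⟩
  ring : ∀ α κ Fa Fb Faa Fab Fba Fbb Xaa Xab Xba Xbb Yaa Yab Yba Ybb →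
      (α * Fb + ((κ * Fab + (Xaa - Xab)) - (κ * Fbb + (Xba - Xbb))))
    + (α * Fa + ((κ * Fba + (Ybb - Yba)) - (κ * Faa + (Yab - Yaa))))
    ≡ α * (Fa + Fb)
    + (((- κ * Faa + (Xaa + Yaa)) - (- κ * Fab + (Xab + Yab)))
      - ((- κ * Fba + (Xba + Yba)) - (- κ * Fbb + (Xbb + Ybb))))
  ring = solve-∀

zero-expansion : ∀ x → [] ≃ const 0ℤ ⊕ x ⊗ []
zero-expansion x = byPairing (atom []) (scalar 0ℤ ⊞ atom x ⊠ atom []) λ f →
  sym (trans (cong (0ℤ * f [] +_) (pair-zero x)) (zero-term (f [])))
  where
  zero-term : ∀ a → 0ℤ * a + 0ℤ ≡ 0ℤ
  zero-term = solve-∀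

evalP-split : ∀ p x → evalP p x ≃ horner₂ x (pcoeff p 0) (pcoeff p 1) (evalP (drop 2 p) x)
evalP-split [] x =
  ≃-trans (zero-expansion x) (⊕-cong (≃-refl {const 0ℤ}) (⊗-cong (≃-refl {x}) (zero-expansion x)))
evalP-split (c ∷ []) x = ⊕-cong (≃-refl {const c}) (⊗-cong (≃-refl {x}) (zero-expansion x))
evalP-split (c ∷ c′ ∷ p) x = ≃-refl

generator : Bool → NC
generator false = 𝐜
generator true = 𝐝

evalCDWord-∷ : ∀ l w → evalCDWord (l ∷ w) ≡ generator l ⊗ evalCDWord w
evalCDWord-∷ false w = refl
evalCDWord-∷ true w = refl

pair-evalCDWord-++ : ∀ u v f →
  ⟨ evalCDWord (u ++ v) ∣ f ⟩ ≡ ⟨ evalCDWord u ∣ (λ u′ → ⟨ evalCDWord v ∣ (λ v′ → f (u′ ++ v′)) ⟩) ⟩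
pair-evalCDWord-++ [] v f = sym (trans (ℤ.+-identityʳ _) (ℤ.*-identityˡ _))
pair-evalCDWord-++ (l ∷ u) v f = begin
  ⟨ evalCDWord (l ∷ u ++ v) ∣ f ⟩
    ≡⟨ cong ⟨_∣ f ⟩ (evalCDWord-∷ l (u ++ v)) ⟩
  ⟨ G ⊗ evalCDWord (u ++ v) ∣ f ⟩
    ≡⟨ pair-⊗ G (evalCDWord (u ++ v)) f ⟩
  ⟨ G ∣ (λ g → ⟨ evalCDWord (u ++ v) ∣ (λ w → f (g ++ w)) ⟩) ⟩
    ≡⟨ pair-cong G (λ g → trans (pair-evalCDWord-++ u v _) (reassociate g)) ⟩
  ⟨ G ∣ (λ g → ⟨ evalCDWord u ∣ (λ u′ → ⟨ evalCDWord v ∣ (λ v′ → f ((g ++ u′) ++ v′)) ⟩) ⟩) ⟩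
    ≡⟨ sym (pair-⊗ G (evalCDWord u) _) ⟩
  ⟨ G ⊗ evalCDWord u ∣ (λ u′ → ⟨ evalCDWord v ∣ (λ v′ → f (u′ ++ v′)) ⟩) ⟩
    ≡⟨ cong ⟨_∣ _ ⟩ (sym (evalCDWord-∷ l u)) ⟩
  ⟨ evalCDWord (l ∷ u) ∣ (λ u′ → ⟨ evalCDWord v ∣ (λ v′ → f (u′ ++ v′)) ⟩) ⟩ ∎
  where
  open ≡-Reasoning
  G : NC
  G = generator l
  reassociate : ∀ g → ⟨ evalCDWord u ∣ (λ u′ → ⟨ evalCDWord v ∣ (λ v′ → f (g ++ (u′ ++ v′))) ⟩) ⟩
                    ≡ ⟨ evalCDWord u ∣ (λ u′ → ⟨ evalCDWord v ∣ (λ v′ → f ((g ++ u′) ++ v′)) ⟩) ⟩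
  reassociate g = pair-cong (evalCDWord u) λ u′ →
                  pair-cong (evalCDWord v) λ v′ → cong f (sym (++-assoc g u′ v′))

pair-evalCD : ∀ e f → ⟨ evalCD e ∣ f ⟩ ≡ ⟨ e ∣ (λ w → ⟨ evalCDWord w ∣ f ⟩) ⟩
pair-evalCD [] f = refl
pair-evalCD ((z , w) ∷ e) f =
  trans (pair-⊕ (const z ⊗ evalCDWord w) (evalCD e) f)
        (cong₂ _+_ (trans (pair-⊗ (const z) (evalCDWord w) f)
                           (pair-const z (λ u → ⟨ evalCDWord w ∣ (λ v → f (u ++ v)) ⟩)))
                    (pair-evalCD e f))

evalCD-++ : ∀ e e′ → evalCD (e ++ e′) ≡ evalCD e ⊕ evalCD e′
evalCD-++ [] e′ = refl
evalCD-++ ((z , w) ∷ e) e′ =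
  trans (cong (const z ⊗ evalCDWord w ⊕_) (evalCD-++ e e′))
        (sym (++-assoc (const z ⊗ evalCDWord w) (evalCD e) (evalCD e′)))

evalCD-⊗ : ∀ e e′ → evalCD (e ⊗ e′) ≃ evalCD e ⊗ evalCD e′
evalCD-⊗ e e′ = pairing-ext λ f → begin
  ⟨ evalCD (e ⊗ e′) ∣ f ⟩
    ≡⟨ pair-evalCD (e ⊗ e′) f ⟩
  ⟨ e ⊗ e′ ∣ (λ w → ⟨ W w ∣ f ⟩) ⟩
    ≡⟨ pair-⊗ e e′ _ ⟩
  ⟨ e ∣ (λ u → ⟨ e′ ∣ (λ v → ⟨ W (u ++ v) ∣ f ⟩) ⟩) ⟩
    ≡⟨ pair-cong e (λ u → pair-cong e′ (λ v → pair-evalCDWord-++ u v f)) ⟩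
  ⟨ e ∣ (λ u → ⟨ e′ ∣ (λ v → ⟨ W u ∣ (λ u′ → ⟨ W v ∣ (λ v′ → f (u′ ++ v′)) ⟩) ⟩) ⟩) ⟩
    ≡⟨ pair-cong e (λ u → pair-swap e′ (W u) _) ⟩
  ⟨ e ∣ (λ u → ⟨ W u ∣ (λ u′ → ⟨ e′ ∣ (λ v → ⟨ W v ∣ (λ v′ → f (u′ ++ v′)) ⟩) ⟩) ⟩) ⟩
    ≡⟨ pair-cong e (λ u → pair-cong (W u) (λ u′ → sym (pair-evalCD e′ _))) ⟩
  ⟨ e ∣ (λ u → ⟨ W u ∣ (λ u′ → ⟨ evalCD e′ ∣ (λ v′ → f (u′ ++ v′)) ⟩) ⟩) ⟩
    ≡⟨ sym (pair-evalCD e _) ⟩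
  ⟨ evalCD e ∣ (λ u′ → ⟨ evalCD e′ ∣ (λ v′ → f (u′ ++ v′)) ⟩) ⟩
    ≡⟨ sym (pair-⊗ (evalCD e) (evalCD e′) f) ⟩
  ⟨ evalCD e ⊗ evalCD e′ ∣ f ⟩ ∎
  where
  open ≡-Reasoning
  W : List Bool → NC
  W = evalCDWord

-- Membership in ℤ⟨c,d⟩ together with a witnessing expression, as a record
-- so that the element is determined by the type.
record CD (x : NC) : Set where
  constructor witness
  field
    expr  : CDExpr
    value : evalCD expr ≃ x

toInCD : ∀ {x} → CD x → InCD x
toInCD (witness e e≃x) = e , coeffs e≃x

CD-≃ : ∀ {x y} → CD x → x ≃ y → CD y
CD-≃ (witness e e≃x) x≃y = witness e (≃-trans e≃x x≃y)

CD-⊕ : ∀ {x y} → CD x → CD y → CD (x ⊕ y)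
CD-⊕ (witness e e≃x) (witness e′ e′≃y) =
  witness (e ++ e′) (≃-trans (coeffwise λ w → cong (λ z → coeff z w) (evalCD-++ e e′)) (⊕-cong e≃x e′≃y))

CD-⊗ : ∀ {x y} → CD x → CD y → CD (x ⊗ y)
CD-⊗ (witness e e≃x) (witness e′ e′≃y) =
  witness (e ⊗ e′) (≃-trans (evalCD-⊗ e e′) (⊗-cong e≃x e′≃y))

CD-const : ∀ k → CD (const k)
CD-const k = witness e value
  where
  e : CDExpr
  e = (k , []) ∷ []
  unit : ∀ k a → k * (1ℤ * a) + 0ℤ ≡ k * a
  unit = solve-∀
  value : evalCD e ≃ const k
  value = byPairing (scalar k ⊠ scalar 1ℤ ⊞ atom []) (scalar k) λ f → unit k (f [])

CD-c-multiple : ∀ k → CD (const k ⊗ 𝐜)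
CD-c-multiple k = witness e value
  where
  e : CDExpr
  e = (k , false ∷ []) ∷ []
  unit : ∀ k x y → k * (1ℤ * x + 1ℤ * y) + 0ℤ ≡ k * (x + y)
  unit = solve-∀
  value : evalCD e ≃ const k ⊗ 𝐜
  value = byPairing (scalar k ⊠ (cT ⊠ scalar 1ℤ) ⊞ atom []) (scalar k ⊠ cT) λ f →
    unit k (f (false ∷ [])) (f (true ∷ []))

CD-t² : CD (𝐭 ⊗ 𝐭)
CD-t² = witness e value
  where
  -- the expression c² - 2d
  e : CDExpr
  e = (1ℤ , false ∷ false ∷ []) ∷ (- (1ℤ + 1ℤ) , true ∷ []) ∷ []
  square : ∀ aa ab ba bb →
      1ℤ * ((1ℤ * aa + 1ℤ * ab) + (1ℤ * ba + 1ℤ * bb)) + ((- (1ℤ + 1ℤ)) * (1ℤ * ab + 1ℤ * ba) + 0ℤ)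
    ≡ (aa - ab) - (ba - bb)
  square = solve-∀
  value : evalCD e ≃ 𝐭 ⊗ 𝐭
  value = byPairing (scalar 1ℤ ⊠ (cT ⊠ (cT ⊠ scalar 1ℤ)) ⊞ (scalar (- (1ℤ + 1ℤ)) ⊠ (dT ⊠ scalar 1ℤ) ⊞ atom []))
                    (tT ⊠ tT)
    λ f → square (f (false ∷ false ∷ [])) (f (false ∷ true ∷ []))
                 (f (true ∷ false ∷ [])) (f (true ∷ true ∷ []))

pcoeff-drop : ∀ k p i → pcoeff (drop k p) i ≡ pcoeff p (k +ℕ i)
pcoeff-drop zero p i = refl
pcoeff-drop (suc k) [] i = refl
pcoeff-drop (suc k) (c ∷ p) i = pcoeff-drop k p i

oddPartCoeff-1 : ∀ p → oddPartCoeff p 1 ≡ (1ℤ + 1ℤ) * pcoeff p 1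
oddPartCoeff-1 p = twice (pcoeff p 1)
  where
  twice : ∀ x → x - (- 1ℤ * 1ℤ) * x ≡ (1ℤ + 1ℤ) * x
  twice = solve-∀

oddPartCoeff-drop : ∀ p i → oddPartCoeff (drop 2 p) i ≡ oddPartCoeff p (2 +ℕ i)
oddPartCoeff-drop p i =
  trans (cong (λ x → x - (- 1ℤ) ^ i * x) (pcoeff-drop 2 p i))
        (sign-period (pcoeff p (2 +ℕ i)) ((- 1ℤ) ^ i))
  where
  sign-period : ∀ x e → x - e * x ≡ x - (- 1ℤ * (- 1ℤ * e)) * x
  sign-period = solve-∀

odd-linear : ∀ p q → OddPartsEqual p q → pcoeff p 1 ≡ pcoeff q 1
odd-linear p q odd = ℤ.*-cancelˡ-≡ (1ℤ + 1ℤ) _ _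
  (trans (sym (oddPartCoeff-1 p)) (trans (odd 1) (oddPartCoeff-1 q)))

odd-drop : ∀ p q → OddPartsEqual p q → OddPartsEqual (drop 2 p) (drop 2 q)
odd-drop p q odd i =
  trans (oddPartCoeff-drop p i) (trans (odd (2 +ℕ i)) (sym (oddPartCoeff-drop q i)))

sumValue : Poly → Poly → NC
sumValue p q = evalP p 𝐭 ⊕ evalP q 𝐬

sum-step : ∀ p q → OddPartsEqual p q →
           CD (sumValue (drop 2 p) (drop 2 q)) → CD (sumValue p q)
sum-step p q odd ih =
  CD-≃ (CD-⊕ (CD-const (pcoeff p 0 + pcoeff q 0)) (CD-⊗ CD-t² ih)) (≃-sym decomposition)
  where
  decomposition : sumValue p q
                ≃ const (pcoeff p 0 + pcoeff q 0) ⊕ (𝐭 ⊗ 𝐭) ⊗ sumValue (drop 2 p) (drop 2 q)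
  decomposition =
    ≃-trans (⊕-cong (evalP-split p 𝐭) (evalP-split q 𝐬))
            (sum-step-identity (pcoeff p 0) (pcoeff q 0) (evalP (drop 2 p) 𝐭) (evalP (drop 2 q) 𝐬)
                               (odd-linear p q odd))

sum-CD : ∀ p q → OddPartsEqual p q → CD (sumValue p q)
sum-CD [] [] odd = witness [] ≃-refl
sum-CD [] q@(_ ∷ []) odd = sum-step [] q odd (sum-CD [] [] (odd-drop [] q odd))
sum-CD [] q@(_ ∷ _ ∷ q″) odd = sum-step [] q odd (sum-CD [] q″ (odd-drop [] q odd))
sum-CD p@(_ ∷ []) q odd = sum-step p q odd (sum-CD [] (drop 2 q) (odd-drop p q odd))
sum-CD p@(_ ∷ _ ∷ p″) q odd = sum-step p q odd (sum-CD p″ (drop 2 q) (odd-drop p q odd))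

twistValue : Poly → NC
twistValue p = evalP p 𝐭 ⊗ 𝐛 ⊕ evalP p 𝐬 ⊗ 𝐚

twist-step : ∀ p → CD (twistValue (drop 2 p)) → CD (twistValue p)
twist-step p ih =
  CD-≃ (CD-⊕ (CD-c-multiple (pcoeff p 0)) (CD-⊗ CD-t² (CD-⊕ (CD-const (- pcoeff p 1)) ih)))
       (≃-sym decomposition)
  where
  decomposition : twistValue p
                ≃ const (pcoeff p 0) ⊗ 𝐜 ⊕ (𝐭 ⊗ 𝐭) ⊗ (const (- pcoeff p 1) ⊕ twistValue (drop 2 p))
  decomposition =
    ≃-trans (⊕-cong (⊗-cong (evalP-split p 𝐭) ≃-refl) (⊗-cong (evalP-split p 𝐬) ≃-refl))
            (twist-step-identity (pcoeff p 0) (pcoeff p 1) (evalP (drop 2 p) 𝐭) (evalP (drop 2 p) 𝐬))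

twist-CD : ∀ p → CD (twistValue p)
twist-CD [] = witness [] ≃-refl
twist-CD p@(_ ∷ []) = twist-step p (twist-CD [])
twist-CD p@(_ ∷ _ ∷ p″) = twist-step p (twist-CD p″)

lemma4p5 : (p q : Poly) → OddPartsEqual p q →
    InCD (evalP p (𝐚 ⊕ ⊖ 𝐛) ⊕ evalP q (𝐛 ⊕ ⊖ 𝐚))
    × InCD (evalP p (𝐚 ⊕ ⊖ 𝐛) ⊗ 𝐛 ⊕ evalP p (𝐛 ⊕ ⊖ 𝐚) ⊗ 𝐚)
lemma4p5 p q odd = toInCD (sum-CD p q odd) , toInCD (twist-CD p)
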